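{- Let $\mathbf{H}$ be a Heyting algebra with canonical frame $(X,\upharpoonleft,Y,T)$. Then the full complex algebra $\mathcal{G}(X)$ of stable sets of filters is a complete Heyting algebra and a canonical extension of $\mathbf{H}$, which is identified with the subalgebra $\mathtt{KO}\mathcal{G}(X)$ of compact-open Galois stable sets. Its implication, the residual of intersection, is given by $A\Rightarrow C=\{u\in X:\forall z\in X(z\in A\wedge u\leq z\to z\in C)\}$, and this is equivalent to $A\Rightarrow_T C=\{u\in X:\forall x\in X\,\forall y\in Y(x\in A\wedge C\upharpoonleft y\to uT'xy)\}$.
   Context: Canonical frame: $X$ the set of filters, $Y$ the set of ideals of $\mathbf{H}$; $x\upharpoonleft y$ iff $x\cap y\neq\emptyset$; for $x\in X,v\in Y$, $x\leadsto v$ is the ideal generated by $\{a\to b:a\in x,b\in v\}$; $yTxv$ iff $x\leadsto v\subseteq y$; $uT'xv$ iff for all $y\in Y$, $yTxv$ implies $u\upharpoonleft y$. For $U\subseteq X$, $V\subseteq Y$: $U^{\perp}=\{y:\forall x\in U\ x\upharpoonleft y\}$, ${}^{\perp}V=\{x:\forall y\in V\ x\upharpoonleft y\}$; $\mathcal{G}(X)$ is the complete lattice of stable sets $A={}^\perp(A^\perp)$ ordered by inclusion. $C\upharpoonleft y$ means $c\upharpoonleft y$ for all $c\in C$. The order on $X$ is $u\leq z$ iff $\{u\}^\perp\subseteq\{z\}^\perp$. $X$ carries the topology generated by the basis $\{X_a:a\in H\}$, $X_a=\{x\in X:a\in x\}$; $\mathtt{KO}\mathcal{G}(X)$ is the set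 of stable sets that are compact and open; $\mathbf{H}$ is identified with it via $a\mapsto X_a$. Canonical extension in the sense of Gehrke–Harding. -}

module Defs where

open import Level using (Level; _⊔_; Lift; lift) renaming (suc to lsuc)
open import Data.Product using (Σ; Σ-syntax; ∃; ∃-syntax; _×_; _,_; proj₁)
open import Data.List using (List; []; _∷_; foldr)
open import Data.List.Relation.Unary.All using (All)
open import Data.List.Relation.Unary.Any using (Any)
open import Relation.Unary using (Pred; _⊆_; _≐_; _∩_; _∪_; ⋃; ⋂; _∈_)
import Data.Unit.Polymorphic as Unit
import Data.Empty as Empty
open import Relation.Binary.Lattice.Bundles using (HeytingAlgebra)
open import Function.Bundles using (_⇔_)

module Canonical {c ℓ₁ ℓ₂ : Level} (H : HeytingAlgebra c ℓ₁ ℓ₂) where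

  open HeytingAlgebra H public
    using (Carrier; _≈_; _≤_; _∧_; _∨_; _⇨_)
    renaming (⊤ to 𝟙; ⊥ to 𝟘)

  L : Level
  L = c ⊔ ℓ₁ ⊔ ℓ₂

  -- Filters and ideals of H (not required to be proper)

  record Filter : Set (lsuc L) where
    field
      F      : Pred Carrier L
      top    : F 𝟙
      upward : ∀ {a b} → a ≤ b → F a → F b
      meet   : ∀ {a b} → F a → F b → F (a ∧ b)

  record Ideal : Set (lsuc L) where
    field
      I        : Pred Carrier L
      bot      : I 𝟘
      downward : ∀ {a b} → b ≤ a → I a → I b
      join     : ∀ {a b} → I a → I b → I (a ∨ b)

  open Filter
  open Ideal

  X : Set (lsuc L)
  X = Filter

  Y : Set (lsuc L)
  Y = Ideal

  _↿_ : X → Y → Set L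
  x ↿ y = Σ[ a ∈ Carrier ] (F x a × I y a)

  ⋁ₗ : List Carrier → Carrier
  ⋁ₗ = foldr _∨_ 𝟘

  ⋀ₗ : List Carrier → Carrier
  ⋀ₗ = foldr _∧_ 𝟙

  generatedIdeal : Pred Carrier L → Pred Carrier L
  generatedIdeal S c = Σ[ bs ∈ List Carrier ] (All S bs × c ≤ ⋁ₗ bs)

  _⇝_ : X → Y → Pred Carrier L
  x ⇝ v = generatedIdeal
            (λ d → Σ[ a ∈ Carrier ] Σ[ b ∈ Carrier ] (F x a × I v b × d ≈ (a ⇨ b)))

  T : Y → X → Y → Set L
  T y x v = (x ⇝ v) ⊆ I y

  T′ : X → X → Y → Set (lsuc L)
  T′ u x v = ∀ (y : Y) → T y x v → u ↿ y

  _^⊥ : ∀ {a} → Pred X a → Pred Y (a ⊔ lsuc L)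
  (U ^⊥) y = ∀ (x : X) → U x → x ↿ y

  ⊥^_ : ∀ {a} → Pred Y a → Pred X (a ⊔ lsuc L)
  (⊥^ V) x = ∀ (y : Y) → V y → x ↿ y

  IsStable : ∀ {a} → Pred X a → Set (a ⊔ lsuc L)
  IsStable A = A ≐ (⊥^ (A ^⊥))

  _≤X_ : X → X → Set (lsuc L)
  u ≤X z = ∀ (y : Y) → u ↿ y → z ↿ y

  SSet : Set (lsuc (lsuc L))
  SSet = Pred X (lsuc L)

  ⋀G : (J : Set (lsuc L)) → (J → SSet) → SSet
  ⋀G J A = ⋂ J A

  ⋁G : ∀ {i} (J : Set i) → (J → SSet) → Pred X (i ⊔ lsuc L)
  ⋁G J A = ⊥^ ((⋃ J A) ^⊥)

  _∨G_ : SSet → SSet → SSet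
  A ∨G B = ⊥^ ((A ∪ B) ^⊥)

  ⊤G : SSet
  ⊤G = λ _ → Unit.⊤ {lsuc L}

  ⊥G : SSet
  ⊥G = ⊥^ ((λ (_ : X) → Lift (lsuc L) Empty.⊥) ^⊥)

  _⇒_ : SSet → SSet → SSet
  (A ⇒ C) u = ∀ (z : X) → A z → u ≤X z → C z

  _↿S_ : SSet → Y → Set (lsuc L)
  C ↿S y = ∀ (c : X) → C c → c ↿ y

  _⇒T_ : SSet → SSet → SSet
  (A ⇒T C) u = ∀ (x : X) (y : Y) → A x → C ↿S y → T′ u x y

  X_ : Carrier → SSet
  X_ a x = Lift (lsuc L) (F x a)

  meetImg : Pred Carrier L → SSet
  meetImg S x = ∀ (a : Carrier) → S a → X_ a x

  joinImg : Pred Carrier L → SSet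
  joinImg S = ⋁G (Σ[ a ∈ Carrier ] S a) (λ p → X_ (proj₁ p))

  IsOpen : SSet → Set (lsuc L)
  IsOpen U = ∀ (x : X) → U x → Σ[ a ∈ Carrier ] (F x a × (X_ a ⊆ U))

  IsCompact : SSet → Set (lsuc (lsuc L))
  IsCompact A = ∀ (J : Set (lsuc L)) (U : J → SSet) → (∀ j → IsOpen (U j)) →
                A ⊆ ⋃ J U →
                Σ[ js ∈ List J ] (A ⊆ (λ x → Any (λ j → U j x) js))

{-# OPTIONS --safe #-}
-- Filters are ordered by inclusion, so stable sets are up-sets and any two
-- filters u, x have a join u ⊔ x.  The ideal x ⇝ y generated by the a ⇨ b is
-- {d : d ∧ a ≤ b for some a ∈ x, b ∈ y}; hence u T′ x y holds iff u meets
-- x ⇝ y, iff u ⊔ x meets y.  So u ∈ A ⇒ C and u ∈ A ⇒T C both say that u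
-- meets x ⇝ y for every x ∈ A and y ∈ C⊥, an intersection of stable sets.
-- Principal filters and ideals, and those generated by subsets of H, witness
-- the embedding a ↦ X_a, its density and its compactness.
module Submission where

open import Defs
open import Level using (Level; _⊔_; Lift; lift; lower) renaming (suc to lsuc)
open import Function.Base using (id; _∘_)
open import Data.Product using (Σ; Σ-syntax; _×_; _,_; proj₁; proj₂)
open import Data.Sum using (inj₁; inj₂)
open import Data.List using (List; []; _∷_; _++_; map)
open import Data.List.Relation.Unary.All as All using (All; []; _∷_)
import Data.List.Relation.Unary.All.Properties as Allₚ
open import Data.List.Relation.Unary.Any as Any using (Any; here; there)
import Data.List.Relation.Unary.Any.Properties as Anyₚ
open import Relation.Unary using (Pred; _⊆_; _≐_; _∩_; _∪_; ⋃; ⋂)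
open import Relation.Binary.Lattice.Bundles using (HeytingAlgebra)
import Relation.Binary.Lattice.Properties.HeytingAlgebra as HeytingProperties
import Relation.Binary.Lattice.Properties.MeetSemilattice as MeetProperties
open import Function.Bundles using (_⇔_; mk⇔; module Equivalence)
import Data.Unit.Polymorphic as Unit

module CanonicalExtension {c ℓ₁ ℓ₂ : Level} (H : HeytingAlgebra c ℓ₁ ℓ₂) where
  open Canonical H
  open Filter
  open Ideal
  open HeytingAlgebra H using
    ( transpose-⇨; transpose-∧; x≤x∨y; y≤x∨y; ∨-least; x∧y≤x; x∧y≤y; ∧-greatest
    ; maximum; minimum; antisym; reflexive; meetSemilattice; module Eq )
    renaming (refl to ≤-refl; trans to ≤-trans)
  open HeytingProperties H using (⇨-eval)
  open MeetProperties meetSemilattice using (∧-monotonic)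

  ↑_ : Carrier → X
  ↑ a = record
    { F      = λ b → Lift L (a ≤ b)
    ; top    = lift (maximum a)
    ; upward = λ b≤b′ a≤b → lift (≤-trans (lower a≤b) b≤b′)
    ; meet   = λ a≤b a≤b′ → lift (∧-greatest (lower a≤b) (lower a≤b′))
    }

  ↓_ : Carrier → Y
  ↓ a = record
    { I        = λ b → Lift L (b ≤ a)
    ; bot      = lift (minimum a)
    ; downward = λ b′≤b b≤a → lift (≤-trans b′≤b (lower b≤a))
    ; join     = λ b≤a b′≤a → lift (∨-least (lower b≤a) (lower b′≤a))
    }

  ↑-refl : ∀ {a} → F (↑ a) a
  ↑-refl = lift ≤-refl

  ↑↿⇒∈ : ∀ {a} (y : Y) → (↑ a) ↿ y → I y a
  ↑↿⇒∈ y (b , a≤b , yb) = downward y (lower a≤b) yb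

  ↿↓⇒∈ : ∀ {a} (x : X) → x ↿ (↓ a) → F x a
  ↿↓⇒∈ x (b , xb , b≤a) = upward x (lower b≤a) xb

  ⊆⇒≤X : (u z : X) → (∀ {a} → F u a → F z a) → u ≤X z
  ⊆⇒≤X u z u⊆z y (a , ua , ya) = a , u⊆z ua , ya

  ≤X⇒⊆ : (u z : X) → u ≤X z → ∀ {a} → F u a → F z a
  ≤X⇒⊆ u z u≤z {a} ua = ↿↓⇒∈ z (u≤z (↓ a) (a , ua , lift ≤-refl))

  closure : ∀ {a} → Pred X a → Pred X (a ⊔ lsuc L)
  closure U = ⊥^ (U ^⊥)

  ⊆-closure : ∀ {a} (U : Pred X a) → U ⊆ closure U
  ⊆-closure U Ux y Uy = Uy _ Ux

  closure⊆⇒stable : ∀ {a} (A : Pred X a) → closure A ⊆ A → IsStable A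
  closure⊆⇒stable A cl⊆A = (λ {x} → ⊆-closure A {x}) , cl⊆A

  closure-stable : ∀ {a} (U : Pred X a) → IsStable (closure U)
  closure-stable U = closure⊆⇒stable (closure U) (λ x∈cl² y Uy → x∈cl² y (λ z z∈cl → z∈cl y Uy))

  ⋂-stable : ∀ {i} (J : Set i) (A : J → SSet) → (∀ j → IsStable (A j)) → IsStable (⋂ J A)
  ⋂-stable J A stable =
    closure⊆⇒stable (⋂ J A) λ x∈cl j → proj₂ (stable j) (λ y Ajy → x∈cl y (λ x′ x′∈⋂ → Ajy x′ (x′∈⋂ j)))

  IsUpSet : ∀ {a} → Pred X a → Set (a ⊔ lsuc L)
  IsUpSet U = ∀ {u z} → U u → u ≤X z → U z

  stable⇒upSet : ∀ {a} {A : Pred X a} → IsStable A → IsUpSet A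
  stable⇒upSet {A = A} stable {u} Au u≤z = proj₂ stable (λ y Ay → u≤z y (Ay u Au))

  ⋁ₗ-++ˡ : ∀ xs ys → ⋁ₗ xs ≤ ⋁ₗ (xs ++ ys)
  ⋁ₗ-++ˡ []       ys = minimum _
  ⋁ₗ-++ˡ (x ∷ xs) ys = ∨-least (x≤x∨y _ _) (≤-trans (⋁ₗ-++ˡ xs ys) (y≤x∨y _ _))

  ⋁ₗ-++ʳ : ∀ xs ys → ⋁ₗ ys ≤ ⋁ₗ (xs ++ ys)
  ⋁ₗ-++ʳ []       ys = ≤-refl
  ⋁ₗ-++ʳ (x ∷ xs) ys = ≤-trans (⋁ₗ-++ʳ xs ys) (y≤x∨y _ _)

  ⋀ₗ-++ˡ : ∀ xs ys → ⋀ₗ (xs ++ ys) ≤ ⋀ₗ xs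
  ⋀ₗ-++ˡ []       ys = maximum _
  ⋀ₗ-++ˡ (x ∷ xs) ys = ∧-greatest (x∧y≤x _ _) (≤-trans (x∧y≤y _ _) (⋀ₗ-++ˡ xs ys))

  ⋀ₗ-++ʳ : ∀ xs ys → ⋀ₗ (xs ++ ys) ≤ ⋀ₗ ys
  ⋀ₗ-++ʳ []       ys = ≤-refl
  ⋀ₗ-++ʳ (x ∷ xs) ys = ≤-trans (x∧y≤y _ _) (⋀ₗ-++ʳ xs ys)

  ⋁ₗ-∈ : (y : Y) {bs : List Carrier} → All (I y) bs → I y (⋁ₗ bs)
  ⋁ₗ-∈ y []         = bot y
  ⋁ₗ-∈ y (yb ∷ ybs) = join y yb (⋁ₗ-∈ y ybs)

  ⋁ₗ-∈-filter : (x : X) {as : List Carrier} → Any (F x) as → F x (⋁ₗ as)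
  ⋁ₗ-∈-filter x (here xa)   = upward x (x≤x∨y _ _) xa
  ⋁ₗ-∈-filter x (there xas) = upward x (y≤x∨y _ _) (⋁ₗ-∈-filter x xas)

  generatedIdeal-least : (S : Pred Carrier L) (y : Y) → (∀ {d} → S d → I y d) →
                         generatedIdeal S ⊆ I y
  generatedIdeal-least S y S⊆y (bs , Sbs , d≤⋁bs) = downward y d≤⋁bs (⋁ₗ-∈ y (All.map S⊆y Sbs))

  idealGeneratedBy : Pred Carrier L → Y
  idealGeneratedBy S = record
    { I        = generatedIdeal S
    ; bot      = [] , [] , ≤-refl
    ; downward = λ d′≤d (bs , Sbs , d≤) → bs , Sbs , ≤-trans d′≤d d≤
    ; join     = λ (bs , Sbs , d≤) (bs′ , Sbs′ , d′≤) →
        bs ++ bs′ , Allₚ.++⁺ Sbs Sbs′ ,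
        ∨-least (≤-trans d≤ (⋁ₗ-++ˡ bs bs′)) (≤-trans d′≤ (⋁ₗ-++ʳ bs bs′))
    }

  filterGeneratedBy : Pred Carrier L → X
  filterGeneratedBy S = record
    { F      = λ d → Σ[ as ∈ List Carrier ] (All S as × ⋀ₗ as ≤ d)
    ; top    = [] , [] , ≤-refl
    ; upward = λ d≤d′ (as , Sas , ≤d) → as , Sas , ≤-trans ≤d d≤d′
    ; meet   = λ (as , Sas , ≤d) (as′ , Sas′ , ≤d′) →
        as ++ as′ , Allₚ.++⁺ Sas Sas′ ,
        ∧-greatest (≤-trans (⋀ₗ-++ˡ as as′) ≤d) (≤-trans (⋀ₗ-++ʳ as as′) ≤d′)
    }

  _⊔F_ : X → X → X
  x ⊔F z = record
    { F      = λ d → Σ[ e ∈ Carrier ] Σ[ a ∈ Carrier ] (F x e × F z a × e ∧ a ≤ d)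
    ; top    = 𝟙 , 𝟙 , top x , top z , maximum _
    ; upward = λ d≤d′ (e , a , xe , za , e∧a≤d) → e , a , xe , za , ≤-trans e∧a≤d d≤d′
    ; meet   = λ (e , a , xe , za , e∧a≤d) (e′ , a′ , xe′ , za′ , e′∧a′≤d′) →
        e ∧ e′ , a ∧ a′ , meet x xe xe′ , meet z za za′ ,
        ∧-greatest (≤-trans (∧-monotonic (x∧y≤x _ _) (x∧y≤x _ _)) e∧a≤d)
                   (≤-trans (∧-monotonic (x∧y≤y _ _) (x∧y≤y _ _)) e′∧a′≤d′)
    }

  ≤X-⊔Fˡ : (x z : X) → x ≤X (x ⊔F z)
  ≤X-⊔Fˡ x z = ⊆⇒≤X x (x ⊔F z) (λ {e} xe → e , 𝟙 , xe , top z , x∧y≤x _ _)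

  ≤X-⊔Fʳ : (x z : X) → z ≤X (x ⊔F z)
  ≤X-⊔Fʳ x z = ⊆⇒≤X z (x ⊔F z) (λ {a} za → 𝟙 , a , top x , za , x∧y≤y _ _)

  _⇝ᴵ_ : X → Y → Y
  x ⇝ᴵ v = record
    { I        = λ d → Σ[ a ∈ Carrier ] Σ[ b ∈ Carrier ] (F x a × I v b × d ∧ a ≤ b)
    ; bot      = 𝟙 , 𝟘 , top x , bot v , x∧y≤x _ _
    ; downward = λ d′≤d (a , b , xa , vb , d∧a≤b) →
        a , b , xa , vb , ≤-trans (∧-monotonic d′≤d ≤-refl) d∧a≤b
    ; join     = λ (a , b , xa , vb , d∧a≤b) (a′ , b′ , xa′ , vb′ , d′∧a′≤b′) →
        a ∧ a′ , b ∨ b′ , meet x xa xa′ , join v vb vb′ ,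
        transpose-∧ (∨-least
          (transpose-⇨ (≤-trans (∧-monotonic ≤-refl (x∧y≤x _ _)) (≤-trans d∧a≤b (x≤x∨y _ _))))
          (transpose-⇨ (≤-trans (∧-monotonic ≤-refl (x∧y≤y _ _)) (≤-trans d′∧a′≤b′ (y≤x∨y _ _)))))
    }

  ⇝⊆⇝ᴵ : (x : X) (v : Y) → (x ⇝ v) ⊆ I (x ⇝ᴵ v)
  ⇝⊆⇝ᴵ x v = generatedIdeal-least _ (x ⇝ᴵ v)
    (λ (a , b , xa , vb , d≈a⇨b) → a , b , xa , vb , transpose-∧ (reflexive d≈a⇨b))

  ⇝ᴵ⊆⇝ : (x : X) (v : Y) → I (x ⇝ᴵ v) ⊆ (x ⇝ v)
  ⇝ᴵ⊆⇝ x v (a , b , xa , vb , d∧a≤b) =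
    (a ⇨ b) ∷ [] , (a , b , xa , vb , Eq.refl) ∷ [] ,
    ≤-trans (transpose-⇨ d∧a≤b) (x≤x∨y _ _)

  T′⇔↿⇝ᴵ : (u x : X) (v : Y) → T′ u x v ⇔ u ↿ (x ⇝ᴵ v)
  T′⇔↿⇝ᴵ u x v = mk⇔ (λ uT′xv → uT′xv (x ⇝ᴵ v) (⇝⊆⇝ᴵ x v))
                      (λ (d , ud , d∈) y yTxv → d , ud , yTxv (⇝ᴵ⊆⇝ x v d∈))

  ↿⇝ᴵ⇒↿ : (x : X) (v : Y) → x ↿ (x ⇝ᴵ v) → x ↿ v
  ↿⇝ᴵ⇒↿ x v (d , xd , a , b , xa , vb , d∧a≤b) = b , upward x d∧a≤b (meet x xd xa) , vb

  _⇒ᴵ_ : SSet → SSet → SSet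
  (A ⇒ᴵ C) u = ∀ (x : X) (y : Y) → A x → C ↿S y → u ↿ (x ⇝ᴵ y)

  -- u ⊔F x lies in A and above u, hence in C, so it meets y.
  ⇒⊆⇒ᴵ : (A C : SSet) → IsUpSet A → (A ⇒ C) ⊆ (A ⇒ᴵ C)
  ⇒⊆⇒ᴵ A C upA {u} u∈A⇒C x y Ax C↿y =
    let (b , (e , a , ue , xa , e∧a≤b) , yb) =
          C↿y (u ⊔F x) (u∈A⇒C (u ⊔F x) (upA Ax (≤X-⊔Fʳ u x)) (≤X-⊔Fˡ u x))
    in e , ue , a , b , xa , yb , e∧a≤b

  ⇒ᴵ⊆⇒ : (A C : SSet) → IsStable C → (A ⇒ᴵ C) ⊆ (A ⇒ C)
  ⇒ᴵ⊆⇒ A C stableC u∈A⇒ᴵC z Az u≤z =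
    proj₂ stableC (λ y C↿y → ↿⇝ᴵ⇒↿ z y (u≤z (z ⇝ᴵ y) (u∈A⇒ᴵC z y Az C↿y)))

  ⇒-stable : (A C : SSet) → IsUpSet A → IsStable C → IsStable (A ⇒ C)
  ⇒-stable A C upA stableC =
    closure⊆⇒stable (A ⇒ C) λ {u} u∈cl → ⇒ᴵ⊆⇒ A C stableC {u} (λ x y Ax C↿y →
      u∈cl (x ⇝ᴵ y) (λ w w∈A⇒C → ⇒⊆⇒ᴵ A C upA {w} w∈A⇒C x y Ax C↿y))

  ⇒≐⇒T : (A C : SSet) → IsUpSet A → IsStable C → (A ⇒ C) ≐ (A ⇒T C)
  ⇒≐⇒T A C upA stableC =
      (λ {u} u∈⇒ x y Ax C↿y → Equivalence.from (T′⇔↿⇝ᴵ u x y) (⇒⊆⇒ᴵ A C upA {u} u∈⇒ x y Ax C↿y))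
    , (λ {u} u∈⇒T → ⇒ᴵ⊆⇒ A C stableC {u} λ x y Ax C↿y → Equivalence.to (T′⇔↿⇝ᴵ u x y) (u∈⇒T x y Ax C↿y))

  ⇒-residual : (A B C : SSet) → IsUpSet B → ((B ∩ A) ⊆ C) ⇔ (B ⊆ (A ⇒ C))
  ⇒-residual A B C upB = mk⇔ (λ B∩A⊆C {u} Bu z Az u≤z → B∩A⊆C (upB Bu u≤z , Az))
                              (λ B⊆A⇒C {u} (Bu , Au) → B⊆A⇒C Bu u Au (λ y → id))

  closure⊆X_ : ∀ {i} (a : Carrier) (U : Pred X i) → U ⊆ X_ a → closure U ⊆ X_ a
  closure⊆X_ a U U⊆Xa {x} x∈cl =
    lift (↿↓⇒∈ x (x∈cl (↓ a) (λ x′ Ux′ → a , lower (U⊆Xa Ux′) , lift ≤-refl)))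

  X_-stable : (a : Carrier) → IsStable (X_ a)
  X_-stable a = closure⊆⇒stable (X_ a) λ {x} → closure⊆X_ a (X_ a) id {x}

  X_-injective : (a b : Carrier) → X_ a ≐ X_ b → a ≈ b
  X_-injective a b (Xa⊆Xb , Xb⊆Xa) =
    antisym (lower (lower (Xa⊆Xb {↑ a} (lift ↑-refl)))) (lower (lower (Xb⊆Xa {↑ b} (lift ↑-refl))))

  X_-∧ : (a b : Carrier) → X_ (a ∧ b) ≐ (X_ a ∩ X_ b)
  X_-∧ a b = (λ {x} (lift xa∧b) → lift (upward x (x∧y≤x _ _) xa∧b) , lift (upward x (x∧y≤y _ _) xa∧b))
           , (λ {x} (lift xa , lift xb) → lift (meet x xa xb))

  X_-∨ : (a b : Carrier) → X_ (a ∨ b) ≐ (X_ a ∨G X_ b)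
  X_-∨ a b = (λ (lift xa∨b) y y∈⊥ →
                a ∨ b , xa∨b , join y (↑↿⇒∈ y (y∈⊥ (↑ a) (inj₁ (lift ↑-refl))))
                                      (↑↿⇒∈ y (y∈⊥ (↑ b) (inj₂ (lift ↑-refl)))))
           , (λ {x} → closure⊆X_ (a ∨ b) (X_ a ∪ X_ b) (λ {x′} → Xa∪Xb⊆Xa∨b {x′}) {x})
    where
    Xa∪Xb⊆Xa∨b : (X_ a ∪ X_ b) ⊆ X_ (a ∨ b)
    Xa∪Xb⊆Xa∨b {x} (inj₁ (lift xa)) = lift (upward x (x≤x∨y _ _) xa)
    Xa∪Xb⊆Xa∨b {x} (inj₂ (lift xb)) = lift (upward x (y≤x∨y _ _) xb)

  -- For the converse, x ∈ X_a ⇒ X_b is applied to the join of x with ↑ a.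
  X_-⇨ : (a b : Carrier) → X_ (a ⇨ b) ≐ (X_ a ⇒ X_ b)
  X_-⇨ a b =
      (λ {x} (lift xa⇨b) z (lift za) x≤z → lift (upward z ⇨-eval (meet z (≤X⇒⊆ x z x≤z xa⇨b) za)))
    , (λ {x} x∈⇒ →
        let (e , a′ , xe , a≤a′ , e∧a′≤b) =
              lower (x∈⇒ (x ⊔F (↑ a)) (lift (𝟙 , a , top x , ↑-refl , x∧y≤y _ _)) (≤X-⊔Fˡ x (↑ a)))
        in lift (upward x (transpose-⇨ (≤-trans (∧-monotonic ≤-refl (lower a≤a′)) e∧a′≤b)) xe))

  X_-𝟙 : X_ 𝟙 ≐ ⊤G
  X_-𝟙 = (λ _ → Unit.tt) , (λ {x} _ → lift (top x))

  X_-𝟘 : X_ 𝟘 ≐ ⊥G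
  X_-𝟘 = (λ (lift x𝟘) y _ → 𝟘 , x𝟘 , bot y) , (λ {x} → closure⊆X_ 𝟘 _ (λ {_} ()) {x})

  stable≐⋁meetImg : (A : SSet) → IsStable A →
    Σ[ J ∈ Set (lsuc L) ] Σ[ S ∈ (J → Pred Carrier L) ] (A ≐ ⋁G J (λ j → meetImg (S j)))
  stable≐⋁meetImg A stable =
    Σ X A , F ∘ proj₁ ,
    (λ {w} Aw y y∈⊥ → y∈⊥ w ((w , Aw) , λ _ → lift)) ,
    (λ w∈cl → proj₂ stable (λ y Ay → w∈cl y (λ w′ ((x , Ax) , x⊆w′) →
      Ay w′ (stable⇒upSet stable Ax (⊆⇒≤X x w′ (λ {a} xa → lower (x⊆w′ a xa)))))))

  stable≐⋀joinImg : (A : SSet) → IsStable A →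
    Σ[ J ∈ Set (lsuc L) ] Σ[ S ∈ (J → Pred Carrier L) ] (A ≐ ⋀G J (λ j → joinImg (S j)))
  stable≐⋀joinImg A stable =
    Σ Y (A ^⊥) , I ∘ proj₁ ,
    (λ {x} Ax (y , Ay) y′ y′∈⊥ → let (a , xa , ya) = Ay x Ax in y′∈⊥ x ((a , ya) , lift xa)) ,
    (λ x∈⋀ → proj₂ stable (λ y Ay → x∈⋀ (y , Ay) y (λ x′ ((a , ya) , lift x′a) → a , x′a , ya)))

  -- Test the inclusion on the filter generated by S against the ideal generated by S′.
  meetImg⊆joinImg⇒⋀ₗ≤⋁ₗ : (S S′ : Pred Carrier L) → meetImg S ⊆ joinImg S′ →
    Σ[ as ∈ List Carrier ] Σ[ bs ∈ List Carrier ] (All S as × All S′ bs × (⋀ₗ as ≤ ⋁ₗ bs))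
  meetImg⊆joinImg⇒⋀ₗ≤⋁ₗ S S′ meet⊆join =
    let (d , (as , Sas , ⋀as≤d) , (bs , S′bs , d≤⋁bs)) =
          meet⊆join {filterGeneratedBy S}
            (λ a Sa → lift (a ∷ [] , Sa ∷ [] , x∧y≤x _ _))
            (idealGeneratedBy S′)
            (λ x ((b , S′b) , lift xb) → b , xb , b ∷ [] , S′b ∷ [] , x≤x∨y _ _)
    in as , bs , Sas , S′bs , ≤-trans ⋀as≤d d≤⋁bs

  IsOpen-resp-≐ : {A B : SSet} → A ≐ B → IsOpen B → IsOpen A
  IsOpen-resp-≐ (A⊆B , B⊆A) openB x Ax =
    let (a , xa , Xa⊆B) = openB x (A⊆B Ax) in a , xa , B⊆A ∘ Xa⊆B

  IsCompact-resp-≐ : {A B : SSet} → A ≐ B → IsCompact B → IsCompact A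
  IsCompact-resp-≐ (A⊆B , B⊆A) compactB J U openU A⊆⋃U =
    let (js , B⊆U) = compactB J U openU (A⊆⋃U ∘ B⊆A) in js , B⊆U ∘ A⊆B

  X_-open : (a : Carrier) → IsOpen (X_ a)
  X_-open a x (lift xa) = a , xa , id

  X_-compact : (a : Carrier) → IsCompact (X_ a)
  X_-compact a J U openU Xa⊆⋃U =
    let (j , U↑a) = Xa⊆⋃U (lift ↑-refl)
        (b , a≤b , Xb⊆Uj) = openU j (↑ a) U↑a
    in j ∷ [] , λ {x} (lift xa) → here (Xb⊆Uj (lift (upward x (lower a≤b) xa)))

  finiteJoin⊆stable : (A : SSet) → IsStable A → {as : List Carrier} →
                      All (λ a → X_ a ⊆ A) as → X_ (⋁ₗ as) ⊆ A
  finiteJoin⊆stable A stable {as} Xas⊆A {x} (lift x⋁as) =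
    proj₂ stable (λ y Ay → ⋁ₗ as , x⋁as , ⋁ₗ-∈ y (All.map (λ {a} Xa⊆A → ↑↿⇒∈ y (Ay (↑ a) (Xa⊆A {↑ a} (lift ↑-refl)))) Xas⊆A))

  -- Openness covers A by basic sets inside A, compactness picks finitely many.
  compactOpen⇒X_ : (A : SSet) → IsStable A → IsCompact A → IsOpen A → Σ[ a ∈ Carrier ] (A ≐ X_ a)
  compactOpen⇒X_ A stable compactA openA =
    ⋁ₗ (map basic js) ,
    (λ {x} Ax → lift (⋁ₗ-∈-filter x (Anyₚ.map⁺ (Any.map lower (A⊆⋃js Ax))))) ,
    finiteJoin⊆stable A stable (Allₚ.map⁺ (All.universal basic⊆A js))
    where
    basic : Σ X A → Carrier
    basic (x , Ax) = proj₁ (openA x Ax)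

    basic⊆A : (j : Σ X A) → X_ (basic j) ⊆ A
    basic⊆A (x , Ax) = proj₂ (proj₂ (openA x Ax))

    finiteSubcover : Σ[ js ∈ List (Σ X A) ] (A ⊆ λ x → Any (λ j → X_ (basic j) x) js)
    finiteSubcover = compactA (Σ X A) (X_ ∘ basic) (X_-open ∘ basic)
                       (λ {x} Ax → (x , Ax) , lift (proj₁ (proj₂ (openA x Ax))))

    js = proj₁ finiteSubcover
    A⊆⋃js = proj₂ finiteSubcover

  compactOpen⇔X_ : (A : SSet) → IsStable A → (IsCompact A × IsOpen A) ⇔ (Σ[ a ∈ Carrier ] (A ≐ X_ a))
  compactOpen⇔X_ A stable =
    mk⇔ (λ (compactA , openA) → compactOpen⇒X_ A stable compactA openA)
        (λ (a , A≐Xa) → IsCompact-resp-≐ A≐Xa (X_-compact a) , IsOpen-resp-≐ A≐Xa (X_-open a))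

corollary4p6 : ∀ {c ℓ₁ ℓ₂ : Level} (H : HeytingAlgebra c ℓ₁ ℓ₂) →
    let open Canonical H in
    -- (1) G(X) is a complete lattice: stable sets are closed under arbitrary
    --     intersections (meets); closures of unions (joins) are stable
    ((J : Set (Level.suc L)) (A : J → SSet) →
        (∀ j → IsStable (A j)) → IsStable (⋀G J A))
    × ((J : Set (Level.suc L)) (A : J → SSet) → IsStable (⋁G J A))
    -- (2) G(X) is a Heyting algebra with implication ⇒ (residual of ∩)
    × ((A C : SSet) → IsStable A → IsStable C → IsStable (A ⇒ C))
    × ((A B C : SSet) → IsStable A → IsStable B → IsStable C →
        (((B ∩ A) ⊆ C) ⇔ (B ⊆ (A ⇒ C))))
    -- (3) ⇒ coincides with ⇒_T on stable sets
    × ((A C : SSet) → IsStable A → IsStable C → (A ⇒ C) ≐ (A ⇒T C))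
    -- (4) a ↦ X_a is an embedding of Heyting algebras into G(X)
    × ((a : Carrier) → IsStable (X_ a))
    × ((a b : Carrier) → X_ a ≐ X_ b → a ≈ b)
    × ((a b : Carrier) → X_ (a ∧ b) ≐ (X_ a ∩ X_ b))
    × ((a b : Carrier) → X_ (a ∨ b) ≐ (X_ a ∨G X_ b))
    × ((a b : Carrier) → X_ (a ⇨ b) ≐ (X_ a ⇒ X_ b))
    × (X_ 𝟙 ≐ ⊤G)
    × (X_ 𝟘 ≐ ⊥G)
    -- (5) density: every stable set is a join of meets and a meet of joins
    --     of elements of the image
    × ((A : SSet) → IsStable A →
        Σ[ J ∈ Set (Level.suc L) ] Σ[ S ∈ (J → Pred Carrier L) ]
          (A ≐ ⋁G J (λ j → meetImg (S j))))
    × ((A : SSet) → IsStable A →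
        Σ[ J ∈ Set (Level.suc L) ] Σ[ S ∈ (J → Pred Carrier L) ]
          (A ≐ ⋀G J (λ j → joinImg (S j))))
    -- (6) compactness of the extension
    × ((S S′ : Pred Carrier L) → meetImg S ⊆ joinImg S′ →
        Σ[ as ∈ List Carrier ] Σ[ bs ∈ List Carrier ]
          (All S as × All S′ bs × (⋀ₗ as ≤ ⋁ₗ bs)))
    -- (7) the image of H is exactly KO G(X), the compact-open stable sets
    × ((A : SSet) → IsStable A →
        ((IsCompact A × IsOpen A) ⇔ (Σ[ a ∈ Carrier ] (A ≐ X_ a))))
corollary4p6 H =
    ⋂-stable
  , (λ J A → closure-stable (⋃ J A))
  , (λ A C stableA stableC → ⇒-stable A C (stable⇒upSet stableA) stableC)
  , (λ A B C _ stableB _ → ⇒-residual A B C (stable⇒upSet stableB))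
  , (λ A C stableA stableC → ⇒≐⇒T A C (stable⇒upSet stableA) stableC)
  , X_-stable , X_-injective , X_-∧ , X_-∨ , X_-⇨ , X_-𝟙 , X_-𝟘
  , stable≐⋁meetImg , stable≐⋀joinImg
  , meetImg⊆joinImg⇒⋀ₗ≤⋁ₗ
  , compactOpen⇔X_
  where open CanonicalExtension H
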